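{- For every integer $n\ge 2$, $s^*(n)\le s(n)\le s^*(2n)$.
   Context: A hypergraph $H=(V,E)$ has a finite vertex set and a set $E$ of distinct subsets of $V$. A labeling $f:V\to\{1,2,\dots\}$ is sum-distinguishing if the sums $\sum_{v\in e}f(v)$ are distinct for distinct hyperedges $e$. $s(H)$ is the smallest $N$ such that $H$ has a sum-distinguishing labeling with labels in $\{1,\dots,N\}$; $s(n,m)$ is the maximum of $s(H)$ over hypergraphs with $n$ vertices and $m$ hyperedges, and $s(n)=s(n,n)$. For a graph $G$, $N[v]=\{v\}\cup\{u:uv\in E(G)\}$; a labeling $f:V(G)\to\{1,2,\dots\}$ is vertex sum-distinguishing if $\sum_{x\in N[u]}f(x)\ne\sum_{x\in N[v]}f(x)$ whenever $N[u]\ne N[v]$; $s^*(G)$ is the smallest $k$ such that such a labeling with labels in $\{1,\dots,k\}$ exists, and $s^*(n)$ is the maximum of $s^*(G)$ over $n$-vertex graphs $G$. -}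

module Defs where

open import Data.Nat using (ℕ; _≤_; _+_)
open import Data.Bool using (Bool; true; false; if_then_else_; _∨_)
open import Data.Fin using (Fin; _≟_)
open import Data.Vec using (Vec; lookup; tabulate; sum)
open import Data.Fin.Subset using (Subset)
open import Data.Product using (Σ; _×_)
open import Relation.Binary.PropositionalEquality using (_≡_; _≢_)
open import Relation.Nullary.Decidable using (⌊_⌋)

InRange : {n : ℕ} → ℕ → (Fin n → ℕ) → Set
InRange N f = ∀ i → 1 ≤ f i × f i ≤ N

setSum : {n : ℕ} → Subset n → (Fin n → ℕ) → ℕ
setSum e f = sum (tabulate (λ i → if lookup e i then f i else 0))

record Hypergraph (n m : ℕ) : Set where
  field
    edges    : Vec (Subset n) m
    distinct : ∀ i j → lookup edges i ≡ lookup edges j → i ≡ j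
open Hypergraph public

SumDist : {n m : ℕ} → Hypergraph n m → (Fin n → ℕ) → Set
SumDist H f = ∀ i j → setSum (lookup (edges H) i) f ≡ setSum (lookup (edges H) j) f → i ≡ j

SumDistWith : {n m : ℕ} → Hypergraph n m → ℕ → Set
SumDistWith {n} H N = Σ (Fin n → ℕ) (λ f → InRange N f × SumDist H f)

IsLeast : (ℕ → Set) → ℕ → Set
IsLeast P k = P k × (∀ j → P j → k ≤ j)

IsMaxOver : (X : Set) → (X → ℕ → Set) → ℕ → Set
IsMaxOver X Val k = (∀ x v → Val x v → v ≤ k) × Σ X (λ x → Val x k)

Is-s-H : {n m : ℕ} → Hypergraph n m → ℕ → Set
Is-s-H H = IsLeast (SumDistWith H)

Is-s : ℕ → ℕ → ℕ → Set
Is-s n m = IsMaxOver (Hypergraph n m) Is-s-H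

record Graph (n : ℕ) : Set where
  field
    adj    : Fin n → Fin n → Bool
    sym    : ∀ u v → adj u v ≡ adj v u
    irrefl : ∀ v → adj v v ≡ false
open Graph public

closedNbhd : {n : ℕ} → Graph n → Fin n → Subset n
closedNbhd G u = tabulate (λ x → ⌊ u ≟ x ⌋ ∨ adj G u x)

VertexSumDist : {n : ℕ} → Graph n → (Fin n → ℕ) → Set
VertexSumDist G f = ∀ u v → closedNbhd G u ≢ closedNbhd G v →
  setSum (closedNbhd G u) f ≢ setSum (closedNbhd G v) f

VertexSumDistWith : {n : ℕ} → Graph n → ℕ → Set
VertexSumDistWith {n} G k = Σ (Fin n → ℕ) (λ f → InRange k f × VertexSumDist G f)

Is-sStar-G : {n : ℕ} → Graph n → ℕ → Set
Is-sStar-G G = IsLeast (VertexSumDistWith G)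

Is-sStar : ℕ → ℕ → Set
Is-sStar n = IsMaxOver (Graph n) Is-sStar-G

-- Pad the distinct closed neighbourhoods of a graph G to n hyperedges by the singletons {u}
-- of the vertices whose neighbourhood already occurred.  A sum-distinguishing labelling of
-- this hypergraph is vertex sum-distinguishing for G, hence s*(G) ≤ s(n).  Conversely, for a
-- hypergraph H with hyperedges e₁ … eₙ add vertices w₁ … wₙ forming a clique, with wⱼ joined
-- to the vertices of eⱼ.  Then N[wⱼ] = eⱼ ∪ W, so a vertex sum-distinguishing labelling of
-- this 2n-vertex graph, restricted to V, separates the hyperedges; hence s(H) ≤ s*(2n).
-- The least values s(H), s*(G) exist only classically, but the conclusions are decidable
-- inequalities between naturals.

module Submission where

open import Defs
open import Data.Nat using (ℕ; _≤_; _*_)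
open import Data.Product using (_×_)

open import Data.Bool using (Bool; true; false; if_then_else_; _∨_; not)
open import Data.Bool.Properties using (∨-zeroʳ)
import Data.Bool as Bool
open import Data.Empty using (⊥-elim)
open import Data.Fin as Fin using (Fin; toℕ; _↑ˡ_; _↑ʳ_; splitAt; _<_; _≟_)
open import Data.Fin.Induction using (<-wellFounded)
open import Data.Fin.Properties using (toℕ<n; any?; _<?_; <-cmp; splitAt-↑ˡ; splitAt-↑ʳ)
open import Data.Fin.Subset using (Subset; ⁅_⁆; _∈_)
open import Data.Fin.Subset.Properties using (x∈⁅x⁆; x∈⁅y⁆⇒x≡y)
open import Data.Nat as ℕ using (zero; suc; _+_; _^_; _≤?_)
open import Data.Nat.DivMod using (_%_; [m+kn]%n≡m%n)
open import Data.Nat.Induction using (<-rec)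
open import Data.Nat.Properties
  using (≮⇒≥; ≤-trans; <⇒≤; +-assoc; *-comm; *-zeroʳ; *-distribˡ-+; +-identityʳ; +-cancelˡ-≡; *-cancelˡ-≡; m^n>0; ^-monoʳ-≤)
open import Data.Product using (∃; _,_; proj₁; proj₂)
open import Data.Sum using (_⊎_; inj₁; inj₂)
open import Data.Vec using (Vec; []; _∷_; lookup; tabulate; sum)
open import Data.Vec.Properties using (lookup∘tabulate; tabulate∘lookup; tabulate-cong; ≡-dec; lookup⇒[]=; []=⇒lookup)
open import Function using (_∘_; case_of_)
open import Function.Bundles using (mk⇔)
open import Induction.WellFounded using (Acc; acc)
open import Relation.Binary using (tri<; tri≈; tri>)
open import Relation.Binary.PropositionalEquality
  using (_≡_; _≢_; refl; trans; cong; cong₂; ≡-≟-identity; ≢-≟-identity; module ≡-Reasoning)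
open import Relation.Nullary using (¬_; Dec; yes; no; does)
open import Relation.Nullary.Decidable using (⌊_⌋; decidable-stable; _×-dec_; does-⇔)

import Relation.Binary.PropositionalEquality as ≡
open ≡-Reasoning

¬¬-least : {P : ℕ → Set} {N : ℕ} → P N → ¬ ¬ ∃ (IsLeast P)
¬¬-least {P} {N} pN noLeast = unsatisfiable N pN
  where
  unsatisfiable : ∀ k → ¬ P k
  unsatisfiable = <-rec (λ k → ¬ P k)
    λ k below pk → noLeast (k , pk , λ j pj → ≮⇒≥ (λ j<k → below j<k pj))

least-≤-bound : {P Q : ℕ → Set} {N a b : ℕ} → (∀ k → Q k → P k) → Q N →
  IsLeast P a → (∀ k → IsLeast Q k → k ≤ b) → a ≤ b
least-≤-bound {a = a} {b} Q⇒P qN (_ , leastP) bound =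
  decidable-stable (a ≤? b) λ a≰b → ¬¬-least qN λ { (k , qk , leastQ) →
    a≰b (≤-trans (leastP k (Q⇒P k qk)) (bound k (qk , leastQ))) }

maxOfLeast-≤ : {X Y : Set} (P : X → ℕ → Set) (Q : Y → ℕ → Set) {a b : ℕ}
  (F : X → Y) → (∀ x k → Q (F x) k → P x k) → (∀ y → ∃ (Q y)) →
  IsMaxOver X (λ x → IsLeast (P x)) a → IsMaxOver Y (λ y → IsLeast (Q y)) b → a ≤ b
maxOfLeast-≤ P Q F transfer feasible (_ , x , leastA) (maxB , _) =
  least-≤-bound (transfer x) (proj₂ (feasible (F x))) leastA (maxB (F x))

bit : Bool → ℕ
bit b = if b then 1 else 0

bit-injective : ∀ {b b′} → bit b ≡ bit b′ → b ≡ b′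
bit-injective {true}  {true}  _ = refl
bit-injective {false} {false} _ = refl

bit+2*-%2 : ∀ b x → (bit b + 2 * x) % 2 ≡ bit b
bit+2*-%2 b x = begin
  (bit b + 2 * x) % 2  ≡⟨ cong (λ y → (bit b + y) % 2) (*-comm 2 x) ⟩
  (bit b + x * 2) % 2  ≡⟨ [m+kn]%n≡m%n (bit b) x 2 ⟩
  bit b % 2            ≡⟨ bit%2 b ⟩
  bit b                ∎
  where
  bit%2 : ∀ b → bit b % 2 ≡ bit b
  bit%2 true  = refl
  bit%2 false = refl

bit+2*-injective : ∀ b b′ x y → bit b + 2 * x ≡ bit b′ + 2 * y → b ≡ b′ × x ≡ y
bit+2*-injective b b′ x y eq
  with refl ← bit-injective (trans (≡.sym (bit+2*-%2 b x)) (trans (cong (_% 2) eq) (bit+2*-%2 b′ y)))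
  = refl , *-cancelˡ-≡ x y 2 (+-cancelˡ-≡ (bit b) _ _ eq)

setSum-*ˡ : ∀ {n} k (e : Subset n) (f : Fin n → ℕ) → setSum e (λ i → k * f i) ≡ k * setSum e f
setSum-*ˡ k []          f = ≡.sym (*-zeroʳ k)
setSum-*ˡ k (true ∷ e)  f = trans (cong (k * f Fin.zero +_) (setSum-*ˡ k e (f ∘ Fin.suc)))
                                  (≡.sym (*-distribˡ-+ k (f Fin.zero) _))
setSum-*ˡ k (false ∷ e) f = setSum-*ˡ k e (f ∘ Fin.suc)

powerOfTwo : ∀ {n} → Fin n → ℕ
powerOfTwo i = 2 ^ toℕ i

powerOfTwo-inRange : ∀ {n} → InRange (2 ^ n) (powerOfTwo {n})
powerOfTwo-inRange i = m^n>0 2 (toℕ i) , ^-monoʳ-≤ 2 (<⇒≤ (toℕ<n i))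

setSum-powerOfTwo-injective : ∀ {n} (e e′ : Subset n) →
  setSum e powerOfTwo ≡ setSum e′ powerOfTwo → e ≡ e′
setSum-powerOfTwo-injective []      []        _  = refl
setSum-powerOfTwo-injective (b ∷ e) (b′ ∷ e′) eq
  = cong₂ _∷_ (proj₁ digits) (setSum-powerOfTwo-injective e e′ (proj₂ digits))
  where
  binary : bit b + 2 * setSum e powerOfTwo ≡ bit b′ + 2 * setSum e′ powerOfTwo
  binary = begin
    bit b  + 2 * setSum e powerOfTwo    ≡⟨ cong (bit b +_) (setSum-*ˡ 2 e powerOfTwo) ⟨
    setSum (b ∷ e) powerOfTwo           ≡⟨ eq ⟩
    setSum (b′ ∷ e′) powerOfTwo         ≡⟨ cong (bit b′ +_) (setSum-*ˡ 2 e′ powerOfTwo) ⟩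
    bit b′ + 2 * setSum e′ powerOfTwo   ∎

  digits : b ≡ b′ × setSum e powerOfTwo ≡ setSum e′ powerOfTwo
  digits = bit+2*-injective b b′ _ _ binary

powerOfTwo-sumDist : ∀ {n m} (H : Hypergraph n m) → SumDistWith H (2 ^ n)
powerOfTwo-sumDist H = powerOfTwo , powerOfTwo-inRange ,
  λ i j eq → distinct H i j (setSum-powerOfTwo-injective _ _ eq)

powerOfTwo-vertexSumDist : ∀ {n} (G : Graph n) → VertexSumDistWith G (2 ^ n)
powerOfTwo-vertexSumDist G = powerOfTwo , powerOfTwo-inRange ,
  λ u v N≢ eq → N≢ (setSum-powerOfTwo-injective _ _ eq)

_≟ₛ_ : ∀ {n} → (p q : Subset n) → Dec (p ≡ q)
_≟ₛ_ = ≡-dec Bool._≟_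

⌊≟⌋-refl : ∀ {n} (u : Fin n) → ⌊ u ≟ u ⌋ ≡ true
⌊≟⌋-refl u = cong ⌊_⌋ (≡-≟-identity _≟_ refl)

lookup-closedNbhd : ∀ {n} (G : Graph n) u x → lookup (closedNbhd G u) x ≡ (⌊ u ≟ x ⌋ ∨ adj G u x)
lookup-closedNbhd G u = lookup∘tabulate _

u∈closedNbhd[u] : ∀ {n} (G : Graph n) u → u ∈ closedNbhd G u
u∈closedNbhd[u] G u = lookup⇒[]= u _ (trans (lookup-closedNbhd G u u) (cong (_∨ adj G u u) (⌊≟⌋-refl u)))

⁅⁆-injective : ∀ {n} (u v : Fin n) → ⁅ u ⁆ ≡ ⁅ v ⁆ → u ≡ v
⁅⁆-injective u v eq = x∈⁅y⁆⇒x≡y v (≡.subst (u ∈_) eq (x∈⁅x⁆ u))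

⁅u⁆≡closedNbhd⇒≡ : ∀ {n} (G : Graph n) u v → ⁅ u ⁆ ≡ closedNbhd G v → u ≡ v
⁅u⁆≡closedNbhd⇒≡ G u v eq = ≡.sym (x∈⁅y⁆⇒x≡y u (≡.subst (v ∈_) (≡.sym eq) (u∈closedNbhd[u] G v)))

module ClosedNbhdHypergraph {n : ℕ} (G : Graph n) where

  HasEarlierTwin : Fin n → Set
  HasEarlierTwin u = ∃ λ w → w < u × closedNbhd G w ≡ closedNbhd G u

  hasEarlierTwin? : ∀ u → Dec (HasEarlierTwin u)
  hasEarlierTwin? u = any? λ w → (w <? u) ×-dec (closedNbhd G w ≟ₛ closedNbhd G u)

  -- Repeated neighbourhoods are replaced by singletons, which are never closed neighbourhoods
  -- of other vertices; this keeps the n hyperedges distinct.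
  hyperedge : Fin n → Subset n
  hyperedge u with hasEarlierTwin? u
  ... | yes _ = ⁅ u ⁆
  ... | no  _ = closedNbhd G u

  hyperedge-noTwin : ∀ {u} → ¬ HasEarlierTwin u → hyperedge u ≡ closedNbhd G u
  hyperedge-noTwin {u} noTwin with hasEarlierTwin? u
  ... | yes twin = ⊥-elim (noTwin twin)
  ... | no  _    = refl

  hyperedge-injective : ∀ u v → hyperedge u ≡ hyperedge v → u ≡ v
  hyperedge-injective u v eq with hasEarlierTwin? u | hasEarlierTwin? v
  ... | yes _ | yes _ = ⁅⁆-injective u v eq
  ... | yes _ | no  _ = ⁅u⁆≡closedNbhd⇒≡ G u v eq
  ... | no  _ | yes _ = ≡.sym (⁅u⁆≡closedNbhd⇒≡ G v u (≡.sym eq))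
  ... | no noTwinᵤ | no noTwinᵥ with <-cmp u v
  ...   | tri< u<v _ _ = ⊥-elim (noTwinᵥ (u , u<v , eq))
  ...   | tri≈ _ u≡v _ = u≡v
  ...   | tri> _ _ v<u = ⊥-elim (noTwinᵤ (v , v<u , ≡.sym eq))

  hypergraph : Hypergraph n n
  hypergraph = record
    { edges    = tabulate hyperedge
    ; distinct = λ i j eq → hyperedge-injective i j
        (trans (≡.sym (lookup∘tabulate hyperedge i)) (trans eq (lookup∘tabulate hyperedge j)))
    }

  closedNbhd-isEdge : ∀ u → ∃ λ t → lookup (edges hypergraph) t ≡ closedNbhd G u
  closedNbhd-isEdge u = go u (<-wellFounded u)
    where
    go : ∀ u → Acc (_<_ {n}) u → ∃ λ t → lookup (edges hypergraph) t ≡ closedNbhd G u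
    go u (acc earlier) with hasEarlierTwin? u
    ... | no noTwin = u , trans (lookup∘tabulate hyperedge u) (hyperedge-noTwin noTwin)
    ... | yes (w , w<u , N[w]≡N[u]) with t , edge≡N[w] ← go w (earlier w<u) =
      t , trans edge≡N[w] N[w]≡N[u]

  vertexSumDist-from-sumDist : ∀ k → SumDistWith hypergraph k → VertexSumDistWith G k
  vertexSumDist-from-sumDist k (f , inRange , sumDist) = f , inRange , λ u v N≢ sums≡ →
    let tᵤ , eᵤ = closedNbhd-isEdge u
        tᵥ , eᵥ = closedNbhd-isEdge v
        tᵤ≡tᵥ = sumDist tᵤ tᵥ (trans (cong (λ e → setSum e f) eᵤ)
                                (trans sums≡ (cong (λ e → setSum e f) (≡.sym eᵥ))))
    in N≢ (trans (≡.sym eᵤ) (trans (cong (lookup (edges hypergraph)) tᵤ≡tᵥ) eᵥ))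

sum-tabulate-↑ : ∀ n {m} (g : Fin (n + m) → ℕ) →
  sum (tabulate g) ≡ sum (tabulate (g ∘ (_↑ˡ m))) + sum (tabulate (g ∘ (n ↑ʳ_)))
sum-tabulate-↑ zero    g = refl
sum-tabulate-↑ (suc n) g = trans (cong (g Fin.zero +_) (sum-tabulate-↑ n (g ∘ Fin.suc)))
                                 (≡.sym (+-assoc (g Fin.zero) _ _))

vec-ext : ∀ {n} {A : Set} (xs ys : Vec A n) → (∀ i → lookup xs i ≡ lookup ys i) → xs ≡ ys
vec-ext xs ys eq = trans (≡.sym (tabulate∘lookup xs)) (trans (tabulate-cong eq) (tabulate∘lookup ys))

module CliqueIncidenceGraph {n m : ℕ} (H : Hypergraph n m) where

  private
    E : Fin m → Subset n
    E = lookup (edges H)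

  adjacent : Fin n ⊎ Fin m → Fin n ⊎ Fin m → Bool
  adjacent (inj₁ _) (inj₁ _) = false
  adjacent (inj₁ v) (inj₂ j) = lookup (E j) v
  adjacent (inj₂ j) (inj₁ v) = lookup (E j) v
  adjacent (inj₂ i) (inj₂ j) = not (does (i ≟ j))

  adjacent-sym : ∀ x y → adjacent x y ≡ adjacent y x
  adjacent-sym (inj₁ _) (inj₁ _) = refl
  adjacent-sym (inj₁ _) (inj₂ _) = refl
  adjacent-sym (inj₂ _) (inj₁ _) = refl
  adjacent-sym (inj₂ i) (inj₂ j) = cong not (does-⇔ (mk⇔ ≡.sym ≡.sym) (i ≟ j) (j ≟ i))

  adjacent-irrefl : ∀ x → adjacent x x ≡ false
  adjacent-irrefl (inj₁ _) = refl
  adjacent-irrefl (inj₂ j) = cong (not ∘ does) (≡-≟-identity _≟_ {j} refl)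

  graph : Graph (n + m)
  graph = record
    { adj    = λ x y → adjacent (splitAt n x) (splitAt n y)
    ; sym    = λ x y → adjacent-sym (splitAt n x) (splitAt n y)
    ; irrefl = λ x → adjacent-irrefl (splitAt n x)
    }

  N[_] : Fin m → Subset (n + m)
  N[ j ] = closedNbhd graph (n ↑ʳ j)

  lookup-N-original : ∀ j v → lookup N[ j ] (v ↑ˡ m) ≡ lookup (E j) v
  lookup-N-original j v = begin
    lookup N[ j ] (v ↑ˡ m)                                   ≡⟨ lookup-closedNbhd graph (n ↑ʳ j) (v ↑ˡ m) ⟩
    ⌊ n ↑ʳ j ≟ v ↑ˡ m ⌋ ∨ adj graph (n ↑ʳ j) (v ↑ˡ m)        ≡⟨ cong₂ _∨_ (cong ⌊_⌋ (≢-≟-identity _≟_ ↑ʳ≢↑ˡ))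
                                                                (cong₂ adjacent (splitAt-↑ʳ n m j) (splitAt-↑ˡ n v m)) ⟩
    lookup (E j) v                                           ∎
    where
    ↑ʳ≢↑ˡ : n ↑ʳ j ≢ v ↑ˡ m
    ↑ʳ≢↑ˡ eq = case trans (≡.sym (splitAt-↑ʳ n m j)) (trans (cong (splitAt n) eq) (splitAt-↑ˡ n v m)) of λ ()

  lookup-N-clique : ∀ j j′ → lookup N[ j ] (n ↑ʳ j′) ≡ true
  lookup-N-clique j j′ with j ≟ j′
  ... | yes refl = []=⇒lookup (u∈closedNbhd[u] graph (n ↑ʳ j))
  ... | no  j≢j′ = begin
    lookup N[ j ] (n ↑ʳ j′)                                  ≡⟨ lookup-closedNbhd graph (n ↑ʳ j) (n ↑ʳ j′) ⟩
    ⌊ n ↑ʳ j ≟ n ↑ʳ j′ ⌋ ∨ adj graph (n ↑ʳ j) (n ↑ʳ j′)      ≡⟨ cong (_ ∨_) (cong₂ adjacent (splitAt-↑ʳ n m j) (splitAt-↑ʳ n m j′)) ⟩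
    ⌊ n ↑ʳ j ≟ n ↑ʳ j′ ⌋ ∨ not (does (j ≟ j′))               ≡⟨ cong (λ d → ⌊ n ↑ʳ j ≟ n ↑ʳ j′ ⌋ ∨ not (does d)) (≢-≟-identity _≟_ j≢j′) ⟩
    ⌊ n ↑ʳ j ≟ n ↑ʳ j′ ⌋ ∨ true                              ≡⟨ ∨-zeroʳ _ ⟩
    true                                                     ∎

  setSum-N : ∀ (h : Fin (n + m) → ℕ) j →
    setSum N[ j ] h ≡ setSum (E j) (h ∘ (_↑ˡ m)) + sum (tabulate (h ∘ (n ↑ʳ_)))
  setSum-N h j = trans (sum-tabulate-↑ n _) (cong₂ _+_
    (cong sum (tabulate-cong λ v → cong (λ b → if b then h (v ↑ˡ m) else 0) (lookup-N-original j v)))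
    (cong sum (tabulate-cong λ j′ → cong (λ b → if b then h (n ↑ʳ j′) else 0) (lookup-N-clique j j′))))

  N-injective : ∀ i j → N[ i ] ≡ N[ j ] → E i ≡ E j
  N-injective i j eq = vec-ext (E i) (E j) λ v →
    trans (≡.sym (lookup-N-original i v)) (trans (cong (λ s → lookup s (v ↑ˡ m)) eq) (lookup-N-original j v))

  sumDist-from-vertexSumDist : ∀ k → VertexSumDistWith graph k → SumDistWith H k
  sumDist-from-vertexSumDist k (h , inRange , vertexSumDist) = f , inRange ∘ (_↑ˡ m) , sumDist
    where
    f : Fin n → ℕ
    f = h ∘ (_↑ˡ m)

    sumDist : SumDist H f
    sumDist i j sums≡ = decidable-stable (i ≟ j) λ i≢j →
      vertexSumDist (n ↑ʳ i) (n ↑ʳ j)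
        (i≢j ∘ distinct H i j ∘ N-injective i j)
        (trans (setSum-N h i) (trans (cong (_+ _) sums≡) (≡.sym (setSum-N h j))))

sumDistWith-subst : ∀ {n m m′} (eq : m ≡ m′) (H : Hypergraph n m) {k} →
  SumDistWith (≡.subst (Hypergraph n) eq H) k → SumDistWith H k
sumDistWith-subst refl H labelling = labelling

lemma6 : ∀ (n : ℕ) → 2 ≤ n → ∀ (a b c : ℕ) →
    Is-sStar n a → Is-s n n b → Is-sStar (2 * n) c → a ≤ b × b ≤ c
lemma6 n _ a b c s*[n] s[n] s*[2n] =
  maxOfLeast-≤ VertexSumDistWith SumDistWith hypergraph vertexSumDist-from-sumDist
               (λ H → 2 ^ n , powerOfTwo-sumDist H) s*[n] s[n] ,
  maxOfLeast-≤ SumDistWith VertexSumDistWith (graph ∘ pad) sumDist-from-padded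
               (λ G → 2 ^ (2 * n) , powerOfTwo-vertexSumDist G) s[n] s*[2n]
  where
  open ClosedNbhdHypergraph using (hypergraph; vertexSumDist-from-sumDist)
  open CliqueIncidenceGraph using (graph; sumDist-from-vertexSumDist)

  -- 2 * n unfolds to n + (n + 0), not to n + n.
  pad : Hypergraph n n → Hypergraph n (n + 0)
  pad = ≡.subst (Hypergraph n) (≡.sym (+-identityʳ n))

  sumDist-from-padded : ∀ H k → VertexSumDistWith (graph (pad H)) k → SumDistWith H k
  sumDist-from-padded H k =
    sumDistWith-subst (≡.sym (+-identityʳ n)) H ∘ sumDist-from-vertexSumDist (pad H) k
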